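{- There exists an absolute constant $C$ such that $\chi'_{trans}(G)\leq C$ for every graph and every multigraph $G$ if and only if there exists an absolute constant $C$ such that $\chi'_{trans}(H)\leq C$ for every Class 1 graph $H$.
   Context: Graphs are finite without loops or multiple edges; multigraphs may have multiple edges but no loops. A proper $t$-coloring of $G$ is a map $E(G)\to\{1,\dots,t\}$ with adjacent edges receiving distinct colors; $\chi'(G)$ is the chromatic index and $\Delta(G)$ the maximum degree; a graph is Class 1 if $\chi'(G)=\Delta(G)$. $M(f,j)$ is the set of edges of color $j$. Two $t$-colorings differ by at most $n$ color classes if the number of colors $j$ with $M(f,j)\neq M(g,j)$ is at most $n$; proper $t$-colorings $f,g$ are $n$-equivalent if there is a sequence $f_0=f,\dots,f_k=g$ ($k\geq 1$) of proper $t$-colorings with consecutive ones differing by at most $n$ color classes. $\chi'_{trans}(G)$ is the minimum integer $n\geq 2$ such that any two proper $\chi'(G)$-colorings of $G$ are $n$-equivalent. -}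

module Defs where

open import Data.Nat using (ℕ; zero; suc; _≤_; _⊔_)
open import Data.Fin using (Fin)
open import Data.Fin.Properties using (_≟_)
open import Data.Fin.Subset using (Subset; _∉_; ∣_∣)
open import Data.List using (List; length; filter; foldr; map; allFin)
open import Data.Product using (Σ; _×_; _,_; proj₁; proj₂; ∃)
open import Data.Sum using (_⊎_)
open import Relation.Nullary using (¬_)
open import Relation.Nullary.Decidable using (_⊎-dec_)
open import Relation.Binary.PropositionalEquality using (_≡_; _≢_)

record Multigraph : Set where
  field
    nV    : ℕ
    nE    : ℕ
    end₁  : Fin nE → Fin nV
    end₂  : Fin nE → Fin nV
    loopless : ∀ e → end₁ e ≢ end₂ e
open Multigraph public

Incident : (G : Multigraph) → Fin (nE G) → Fin (nV G) → Set
Incident G e v = (end₁ G e ≡ v) ⊎ (end₂ G e ≡ v)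

SameEnds : (G : Multigraph) → Fin (nE G) → Fin (nE G) → Set
SameEnds G e e' =
  ((end₁ G e ≡ end₁ G e') × (end₂ G e ≡ end₂ G e'))
  ⊎ ((end₁ G e ≡ end₂ G e') × (end₂ G e ≡ end₁ G e'))

IsSimple : Multigraph → Set
IsSimple G = ∀ e e' → SameEnds G e e' → e ≡ e'

Adjacent : (G : Multigraph) → Fin (nE G) → Fin (nE G) → Set
Adjacent G e e' = (e ≢ e') × (∃ λ v → Incident G e v × Incident G e' v)

Coloring : Multigraph → ℕ → Set
Coloring G t = Fin (nE G) → Fin t

Proper : (G : Multigraph) (t : ℕ) → Coloring G t → Set
Proper G t f = ∀ e e' → Adjacent G e e' → f e ≢ f e'

IsChromaticIndex : Multigraph → ℕ → Set
IsChromaticIndex G k =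
  (Σ (Coloring G k) (Proper G k))
  × (∀ t → Σ (Coloring G t) (Proper G t) → k ≤ t)

degree : (G : Multigraph) → Fin (nV G) → ℕ
degree G v = length (filter (λ e → (end₁ G e ≟ v) ⊎-dec (end₂ G e ≟ v)) (allFin (nE G)))

maxDegree : Multigraph → ℕ
maxDegree G = foldr _⊔_ 0 (map (degree G) (allFin (nV G)))

IsClass1 : Multigraph → Set
IsClass1 G = IsChromaticIndex G (maxDegree G)

SameClass : (G : Multigraph) (t : ℕ) → Coloring G t → Coloring G t → Fin t → Set
SameClass G t f g j = ∀ e → (f e ≡ j → g e ≡ j) × (g e ≡ j → f e ≡ j)

-- f and g differ by at most n color classes: the set of colors j with
-- M(f,j) ≠ M(g,j) has at most n elements, i.e. is contained in a set S
-- of colors with |S| ≤ n.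
DifferAtMost : (G : Multigraph) (t n : ℕ) → Coloring G t → Coloring G t → Set
DifferAtMost G t n f g =
  Σ (Subset t) λ S → (∣ S ∣ ≤ n) × (∀ j → j ∉ S → SameClass G t f g j)

-- a sequence f = f₀, f₁, …, f_k = g (k ≥ 1) of proper t-colorings with
-- consecutive ones differing by at most n color classes (f₀ proper is
-- assumed separately)
data Chain (G : Multigraph) (t n : ℕ) : Coloring G t → Coloring G t → Set where
  one  : ∀ {f g} → Proper G t g → DifferAtMost G t n f g → Chain G t n f g
  more : ∀ {f h g} → Proper G t h → DifferAtMost G t n f h → Chain G t n h g → Chain G t n f g

Equivalent : (G : Multigraph) (t n : ℕ) → Coloring G t → Coloring G t → Set
Equivalent G t n f g = Proper G t f × Chain G t n f g

AllEquivalent : (G : Multigraph) (k n : ℕ) → Set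
AllEquivalent G k n = ∀ f g → Proper G k f → Proper G k g → Equivalent G k n f g

-- χ'_trans(G) ≤ C, where k = χ'(G): since χ'_trans(G) is the minimum n ≥ 2
-- with AllEquivalent G k n, this says some such n satisfies n ≤ C.
TransAtMost : (G : Multigraph) (k C : ℕ) → Set
TransAtMost G k C = Σ ℕ λ n → (2 ≤ n) × (n ≤ C) × AllEquivalent G k n

-- Replace every edge uv of a multigraph G with χ'(G) = k by a copy of K_{k,k}
-- minus one edge a₀b₀, attached to u at a₀ and to v at b₀.  The result H is a
-- simple graph with maximum degree k and χ'(H) = k, hence Class 1.  A cyclic
-- Latin square extends every proper k-coloring of G to H, and conversely in
-- every proper k-coloring of H the two pendant edges of a gadget carry the same
-- color, so the colors of the pendant edges u a₀ form a proper k-coloring of G.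
-- This restriction maps recoloring sequences of H to recoloring sequences of G,
-- hence χ'_trans(G) ≤ χ'_trans(H).

module Submission where

open import Defs
open import Data.Empty using (⊥-elim)
open import Data.Fin using (Fin; zero; suc; toℕ; punchOut)
open import Data.Fin.Properties
  using ( _≟_; any?; injective⇒≤; punchOut-injective; suc-injective
        ; toℕ-injective; toℕ-fromℕ<; toℕ<n; +↔⊎; *↔×; 1↔⊤)
import Data.Fin.Subset as Subset
open import Data.Fin.Subset.Properties using (∈⊤; ∣⊤∣≡n)
open import Data.List using (List; _∷_; lookup; filter; allFin)
open import Data.List.Membership.Propositional.Properties
  using (∈-allFin; ∈-filter⁺; ∈-filter⁻; ∈-lookup)
open import Data.List.Properties using (foldr-preservesᵇ; foldr-preservesᵒ)
import Data.List.Relation.Unary.All as All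
import Data.List.Relation.Unary.All.Properties as All
import Data.List.Relation.Unary.Any as Any
import Data.List.Relation.Unary.Any.Properties as Any
open import Data.List.Relation.Unary.AllPairs using (_∷_)
open import Data.List.Relation.Unary.Unique.Propositional using (Unique)
import Data.List.Relation.Unary.Unique.Propositional.Properties as Unique
open import Data.Maybe using (Maybe; just; nothing)
open import Data.Maybe.Properties using (just-injective)
open import Data.Nat using (ℕ; zero; suc; _+_; _*_; _∸_; _%_; _<_; _≤_; _⊔_; z≤n; NonZero)
import Data.Nat.Properties as ℕ
open import Algebra.Properties.CommutativeSemigroup ℕ.+-commutativeSemigroup using (xy∙z≈xz∙y)
open import Data.Nat.DivMod
  using (_mod_; m%n<n; m<n⇒m%n≡m; %-distribˡ-+; m%n%n≡m%n; [m+n]%n≡m%n)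
open import Data.Product using (Σ; ∃; _×_; _,_; proj₁; proj₂; uncurry)
open import Data.Product.Function.NonDependent.Propositional using (_×-↔_)
open import Data.Sum as Sum using (_⊎_; inj₁; inj₂; [_,_]′)
open import Data.Sum.Function.Propositional using (_⊎-↔_)
open import Data.Unit using (⊤; tt)
open import Function using (_∘_; _∋_)
open import Function.Bundles using (_↔_; _⇔_; mk⇔; Inverse; Injection)
open import Function.Definitions using (Injective)
open import Function.Properties.Inverse using (↔-refl; ↔-sym; ↔-trans; ↔⇒↣)
open import Relation.Binary.PropositionalEquality
open import Relation.Nullary using (yes; no; contradiction)
open import Relation.Nullary.Decidable using (_⊎-dec_; decidable-stable)

injective⇒onto : ∀ {m} {f : Fin m → Fin m} → Injective _≡_ _≡_ f →
  ∀ y → ∃ λ x → f x ≡ y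
injective⇒onto {zero} _ ()
injective⇒onto {suc m} {f} f-inj y with any? (λ x → f x ≟ y)
... | yes hit = hit
... | no miss = ⊥-elim (ℕ.<-irrefl refl (injective⇒≤ {f = λ x → punchOut (y≢f x)}
        (λ eq → f-inj (punchOut-injective (y≢f _) (y≢f _) eq))))
  where
  y≢f : ∀ x → y ≢ f x
  y≢f x y≡fx = miss (x , sym y≡fx)

-- Rows r i and columns c j of a square array share every cell except the
-- corner, which has a row entry r 0 0 and a column entry c 0 0.  The right
-- columns meet x = r 0 0 in distinct lower rows, hence in all of them, so the
-- left column can only meet x in its corner.
corner-agrees : ∀ {n} (r c : Fin (suc n) → Fin (suc n) → Fin (suc n)) →
  (∀ i → Injective _≡_ _≡_ (r i)) → (∀ j → Injective _≡_ _≡_ (c j)) →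
  (∀ i j → r (suc i) j ≡ c j (suc i)) → (∀ j → r zero (suc j) ≡ c (suc j) zero) →
  r zero zero ≡ c zero zero
corner-agrees {n} r c row-inj col-inj lower upper = left-column-meets (injective⇒onto (col-inj zero) x)
  where
  x = r zero zero

  right-column-meets : ∀ j → ∃ λ i → r (suc i) (suc j) ≡ x
  right-column-meets j with injective⇒onto (col-inj (suc j)) x
  ... | zero , c≡x with () ← row-inj zero (trans (upper j) c≡x)
  ... | suc i , c≡x = i , trans (lower i (suc j)) c≡x

  σ : Fin n → Fin n
  σ j = proj₁ (right-column-meets j)

  σ-injective : Injective _≡_ _≡_ σ
  σ-injective {j} {j'} σj≡σj' = suc-injective (row-inj (suc (σ j'))
    (trans (subst (λ i → r (suc i) (suc j) ≡ x) σj≡σj' (proj₂ (right-column-meets j)))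
           (sym (proj₂ (right-column-meets j')))))

  left-column-meets : (∃ λ i → c zero i ≡ x) → x ≡ c zero zero
  left-column-meets (zero , c≡x) = sym c≡x
  left-column-meets (suc i , c≡x) with injective⇒onto σ-injective i
  ... | j , refl with () ← row-inj (suc (σ j))
                     (trans (lower (σ j) zero) (trans c≡x (sym (proj₂ (right-column-meets j)))))

module _ {n : ℕ} .{{_ : NonZero n}} where

  private
    %-absorbˡ : ∀ p x → (p + x % n) % n ≡ (p + x) % n
    %-absorbˡ p x = begin
      (p + x % n) % n             ≡⟨ %-distribˡ-+ p (x % n) n ⟩
      (p % n + x % n % n) % n     ≡⟨ cong (λ z → (p % n + z) % n) (m%n%n≡m%n x n) ⟩
      (p % n + x % n) % n         ≡⟨ %-distribˡ-+ p x n ⟨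
      (p + x) % n                 ∎
      where open ≡-Reasoning

    unshift : ∀ a b → b < n → (n ∸ a % n + (a + b) % n) % n ≡ b
    unshift a b b<n = begin
      (n ∸ r + (a + b) % n) % n   ≡⟨ cong (λ z → (n ∸ r + z) % n) a+b≡r+b ⟩
      (n ∸ r + (r + b) % n) % n   ≡⟨ %-absorbˡ (n ∸ r) (r + b) ⟩
      (n ∸ r + (r + b)) % n       ≡⟨ cong (_% n) (ℕ.+-assoc (n ∸ r) r b) ⟨
      (n ∸ r + r + b) % n         ≡⟨ cong (λ z → (z + b) % n) (ℕ.m∸n+n≡m r≤n) ⟩
      (n + b) % n                 ≡⟨ cong (_% n) (ℕ.+-comm n b) ⟩
      (b + n) % n                 ≡⟨ [m+n]%n≡m%n b n ⟩
      b % n                       ≡⟨ m<n⇒m%n≡m b<n ⟩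
      b                           ∎
      where
      open ≡-Reasoning
      r = a % n
      r≤n = ℕ.<⇒≤ (m%n<n a n)
      a+b≡r+b : (a + b) % n ≡ (r + b) % n
      a+b≡r+b = trans (%-distribˡ-+ a b n) (cong (λ z → (r + z) % n) (m<n⇒m%n≡m b<n))

  +-%-cancelˡ : ∀ a {b b'} → b < n → b' < n → (a + b) % n ≡ (a + b') % n → b ≡ b'
  +-%-cancelˡ a {b} {b'} b<n b'<n eq = trans (sym (unshift a b b<n))
    (trans (cong (λ z → (n ∸ a % n + z) % n) eq) (unshift a b' b'<n))

module _ {n : ℕ} where

  private
    k = suc n

    mod-toℕ : ∀ m m' → m mod k ≡ m' mod k → m % k ≡ m' % k
    mod-toℕ m m' eq =
      trans (sym (toℕ-fromℕ< (m%n<n m k))) (trans (cong toℕ eq) (toℕ-fromℕ< (m%n<n m' k)))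

  cyclicSquare : Fin k → Fin k → Fin k → Fin k
  cyclicSquare c i j = (toℕ c + toℕ i + toℕ j) mod k

  cyclicSquare-corner : ∀ c → cyclicSquare c zero zero ≡ c
  cyclicSquare-corner c = toℕ-injective (begin
    toℕ (cyclicSquare c zero zero) ≡⟨ toℕ-fromℕ< (m%n<n (toℕ c + 0 + 0) k) ⟩
    (toℕ c + 0 + 0) % k            ≡⟨ cong (_% k) (ℕ.+-identityʳ (toℕ c + 0)) ⟩
    (toℕ c + 0) % k                ≡⟨ cong (_% k) (ℕ.+-identityʳ (toℕ c)) ⟩
    toℕ c % k                      ≡⟨ m<n⇒m%n≡m (toℕ<n c) ⟩
    toℕ c                          ∎)
    where open ≡-Reasoning

  cyclicSquare-row-injective : ∀ c i → Injective _≡_ _≡_ (cyclicSquare c i)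
  cyclicSquare-row-injective c i {j} {j'} eq =
    toℕ-injective (+-%-cancelˡ (toℕ c + toℕ i) (toℕ<n j) (toℕ<n j')
      (mod-toℕ (toℕ c + toℕ i + toℕ j) (toℕ c + toℕ i + toℕ j') eq))

  cyclicSquare-column-injective : ∀ c j → Injective _≡_ _≡_ (λ i → cyclicSquare c i j)
  cyclicSquare-column-injective c j {i} {i'} eq =
    toℕ-injective (+-%-cancelˡ (toℕ c + toℕ j) (toℕ<n i) (toℕ<n i') (begin
      (toℕ c + toℕ j + toℕ i) % k   ≡⟨ cong (_% k) (xy∙z≈xz∙y (toℕ c) (toℕ j) (toℕ i)) ⟩
      (toℕ c + toℕ i + toℕ j) % k   ≡⟨ mod-toℕ (toℕ c + toℕ i + toℕ j) (toℕ c + toℕ i' + toℕ j) eq ⟩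
      (toℕ c + toℕ i' + toℕ j) % k  ≡⟨ cong (_% k) (xy∙z≈xz∙y (toℕ c) (toℕ i') (toℕ j)) ⟩
      (toℕ c + toℕ j + toℕ i') % k  ∎))
    where open ≡-Reasoning

Unique⇒lookup-injective : ∀ {A : Set} {xs : List A} → Unique xs → Injective _≡_ _≡_ (lookup xs)
Unique⇒lookup-injective (x∉xs ∷ u) {zero}  {zero}  _  = refl
Unique⇒lookup-injective (x∉xs ∷ u) {zero}  {suc j} eq = ⊥-elim (All.lookup x∉xs (∈-lookup j) eq)
Unique⇒lookup-injective (x∉xs ∷ u) {suc i} {zero}  eq = ⊥-elim (All.lookup x∉xs (∈-lookup i) (sym eq))
Unique⇒lookup-injective (x∉xs ∷ u) {suc i} {suc j} eq = cong suc (Unique⇒lookup-injective u eq)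

record Star (G : Multigraph) (v : Fin (nV G)) (m : ℕ) : Set where
  constructor star
  field
    ray           : Fin m → Fin (nE G)
    ray-injective : Injective _≡_ _≡_ ray
    ray-incident  : ∀ i → Incident G (ray i) v

module _ {G : Multigraph} {v : Fin (nV G)} where

  private
    incident? = λ e → (end₁ G e ≟ v) ⊎-dec (end₂ G e ≟ v)
    incidentEdges = filter incident? (allFin (nE G))

  star⇒≤colors : ∀ {m t} {f : Coloring G t} → Star G v m → Proper G t f → m ≤ t
  star⇒≤colors {f = f} (star h h-injective h-incident) f-proper =
    injective⇒≤ {f = f ∘ h} λ {i} {j} eq → decidable-stable (i ≟ j) λ i≢j →
      f-proper (h i) (h j) (i≢j ∘ h-injective , v , h-incident i , h-incident j) eq

  degreeStar : Star G v (degree G v)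
  degreeStar = star (lookup incidentEdges)
    (Unique⇒lookup-injective (Unique.filter⁺ incident? (Unique.allFin⁺ (nE G))))
    λ i → proj₂ (∈-filter⁻ incident? {xs = allFin (nE G)} (∈-lookup i))

  star⇒≤degree : ∀ {m} → Star G v m → m ≤ degree G v
  star⇒≤degree (star h h-injective h-incident) =
    injective⇒≤ {f = Any.index ∘ listed} λ {i} {j} eq → h-injective (trans (Any.lookup-index (listed i))
        (trans (cong (lookup incidentEdges) eq) (sym (Any.lookup-index (listed j)))))
    where
    listed = λ i → ∈-filter⁺ incident? (∈-allFin (h i)) (h-incident i)

degree≤colors : ∀ {G t} {f : Coloring G t} → Proper G t f → ∀ v → degree G v ≤ t
degree≤colors {G} f-proper v = star⇒≤colors {G} {v} degreeStar f-proper

maxDegree≤ : ∀ {G k} → (∀ v → degree G v ≤ k) → maxDegree G ≤ k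
maxDegree≤ {G} {k} bound =
  foldr-preservesᵇ {P = _≤ k} ℕ.⊔-lub z≤n
    (All.map⁺ {f = degree G} (All.universal bound (allFin (nV G))))

degree≤maxDegree : ∀ G v → degree G v ≤ maxDegree G
degree≤maxDegree G v =
  foldr-preservesᵒ {P = degree G v ≤_} (λ x y → [ ℕ.m≤n⇒m≤n⊔o y , ℕ.m≤n⇒m≤o⊔n x ]′) 0 _
    (inj₂ (Any.map⁺ (Any.map (λ { refl → ℕ.≤-refl }) (∈-allFin v))))

isChromaticIndex-fromStar : ∀ {G v k} {f : Coloring G k} →
  Proper G k f → Star G v k → IsChromaticIndex G k
isChromaticIndex-fromStar f-proper s =
  (_ , f-proper) , λ t (g , g-proper) → star⇒≤colors s g-proper

isClass1-fromStar : ∀ {G v k} {f : Coloring G k} → Proper G k f → Star G v k → IsClass1 G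
isClass1-fromStar {G} {v} {k} f-proper s = subst (IsChromaticIndex G) (sym maxDegree≡k)
  (isChromaticIndex-fromStar f-proper s)
  where
  maxDegree≡k : maxDegree G ≡ k
  maxDegree≡k = ℕ.≤-antisym (maxDegree≤ {G} (degree≤colors {G} f-proper))
    (ℕ.≤-trans (star⇒≤degree s) (degree≤maxDegree G v))

χ'>0⇒edge : ∀ {G k} → IsChromaticIndex G (suc k) → Fin (nE G)
χ'>0⇒edge {record { nE = zero }}  (_ , minimal) with () ← minimal 0 ((λ ()) , λ ())
χ'>0⇒edge {record { nE = suc _ }} _ = zero

DifferAtMost-restrict : ∀ {G H t n} (ι : Fin (nE G) → Fin (nE H)) {a b : Coloring H t} →
  DifferAtMost H t n a b → DifferAtMost G t n (a ∘ ι) (b ∘ ι)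
DifferAtMost-restrict ι (S , |S|≤n , same) = S , |S|≤n , λ j j∉S e → same j j∉S (ι e)

DifferAtMost-resp-≗ : ∀ {G t n} {f f' g g' : Coloring G t} →
  (∀ e → f' e ≡ f e) → (∀ e → g e ≡ g' e) → DifferAtMost G t n f g → DifferAtMost G t n f' g'
DifferAtMost-resp-≗ f'≗f g≗g' (S , |S|≤n , same) = S , |S|≤n , λ j j∉S e →
  (λ f'e≡j → trans (sym (g≗g' e)) (proj₁ (same j j∉S e) (trans (sym (f'≗f e)) f'e≡j))) ,
  (λ g'e≡j → trans (f'≗f e) (proj₂ (same j j∉S e) (trans (g≗g' e) g'e≡j)))

Chain-restrict : ∀ {G H t n} (ι : Fin (nE G) → Fin (nE H)) →
  (∀ a → Proper H t a → Proper G t (a ∘ ι)) →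
  ∀ {a b} → Chain H t n a b → Chain G t n (a ∘ ι) (b ∘ ι)
Chain-restrict {G} {H} ι restrict-proper (one b-proper d) =
  one (restrict-proper _ b-proper) (DifferAtMost-restrict {G} {H} ι d)
Chain-restrict {G} {H} ι restrict-proper (more h-proper d c) =
  more (restrict-proper _ h-proper) (DifferAtMost-restrict {G} {H} ι d)
    (Chain-restrict ι restrict-proper c)

Chain-resp-≗ : ∀ {G t n} {a b f g : Coloring G t} →
  (∀ e → f e ≡ a e) → (∀ e → b e ≡ g e) → Proper G t g → Chain G t n a b → Chain G t n f g
Chain-resp-≗ {G} f≗a b≗g g-proper (one _ d) =
  one g-proper (DifferAtMost-resp-≗ {G} f≗a b≗g d)
Chain-resp-≗ {G} f≗a b≗g g-proper (more h-proper d c) =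
  more h-proper (DifferAtMost-resp-≗ {G} f≗a (λ _ → refl) d)
    (Chain-resp-≗ (λ _ → refl) b≗g g-proper c)

AllEquivalent-retract : ∀ {G H t n}
  (ι : Fin (nE G) → Fin (nE H)) (extend : Coloring G t → Coloring H t) →
  (∀ a → Proper H t a → Proper G t (a ∘ ι)) →
  (∀ f → Proper G t f → Proper H t (extend f)) →
  (∀ f e → extend f (ι e) ≡ f e) →
  AllEquivalent H t n → AllEquivalent G t n
AllEquivalent-retract ι extend restrict-proper extend-proper retract equivalent f g f-proper g-proper =
  f-proper , Chain-resp-≗ (sym ∘ retract f) (retract g) g-proper (Chain-restrict ι restrict-proper
    (proj₂ (equivalent _ _ (extend-proper f f-proper) (extend-proper g g-proper))))

AllEquivalent-≥colors : ∀ {G k n} → k ≤ n → AllEquivalent G k n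
AllEquivalent-≥colors {k = k} {n} k≤n f g f-proper g-proper =
  f-proper , one g-proper
    (Subset.⊤ , subst (_≤ n) (sym (∣⊤∣≡n k)) k≤n , λ j j∉⊤ → ⊥-elim (j∉⊤ ∈⊤))

module Enumerated {V E : Set} {nv ne : ℕ} (vertices : Fin nv ↔ V) (edges : Fin ne ↔ E)
                  (src tgt : E → V) (src≢tgt : ∀ ε → src ε ≢ tgt ε) where

  private
    module Vertices = Inverse vertices
    module Edges = Inverse edges

  vertexIndex : V → Fin nv
  vertexIndex = Vertices.from

  edgeIndex : E → Fin ne
  edgeIndex = Edges.from

  edgeAt : Fin ne → E
  edgeAt = Edges.to

  edgeAt-edgeIndex : ∀ ε → edgeAt (edgeIndex ε) ≡ ε
  edgeAt-edgeIndex = Edges.strictlyInverseˡ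

  private
    vertexIndex-injective : ∀ {w w'} → vertexIndex w ≡ vertexIndex w' → w ≡ w'
    vertexIndex-injective = Injection.injective (↔⇒↣ (↔-sym vertices))

    edgeIndex-injective : ∀ {ε ε'} → edgeIndex ε ≡ edgeIndex ε' → ε ≡ ε'
    edgeIndex-injective = Injection.injective (↔⇒↣ (↔-sym edges))

    edgeAt-injective : ∀ {x x'} → edgeAt x ≡ edgeAt x' → x ≡ x'
    edgeAt-injective = Injection.injective (↔⇒↣ edges)

  graph : Multigraph
  graph = record
    { nV       = nv
    ; nE       = ne
    ; end₁     = vertexIndex ∘ src ∘ edgeAt
    ; end₂     = vertexIndex ∘ tgt ∘ edgeAt
    ; loopless = λ x eq → src≢tgt (edgeAt x) (vertexIndex-injective eq)
    }

  Meets : E → V → Set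
  Meets ε w = src ε ≡ w ⊎ tgt ε ≡ w

  meets⇒incident : ∀ {ε w} → Meets ε w → Incident graph (edgeIndex ε) (vertexIndex w)
  meets⇒incident {ε} = Sum.map (cong vertexIndex ∘ trans (cong src (edgeAt-edgeIndex ε)))
                               (cong vertexIndex ∘ trans (cong tgt (edgeAt-edgeIndex ε)))

  incident⇒meets : ∀ {x v} → Incident graph x v → Meets (edgeAt x) (Vertices.to v)
  incident⇒meets = Sum.map (λ p → trans (sym (Vertices.strictlyInverseˡ _)) (cong Vertices.to p))
                           (λ p → trans (sym (Vertices.strictlyInverseˡ _)) (cong Vertices.to p))

  ProperOn : (t : ℕ) → (E → Fin t) → Set
  ProperOn t c = ∀ {ε ε' w} → ε ≢ ε' → Meets ε w → Meets ε' w → c ε ≢ c ε'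

  properOn⇒proper : ∀ {t c} → ProperOn t c → Proper graph t (c ∘ edgeAt)
  properOn⇒proper c-proper x x' (x≢x' , v , x∋v , x'∋v) =
    c-proper (x≢x' ∘ edgeAt-injective) (incident⇒meets x∋v) (incident⇒meets x'∋v)

  proper⇒properOn : ∀ {t f} → Proper graph t f → ProperOn t (f ∘ edgeIndex)
  proper⇒properOn f-proper ε≢ε' ε∋w ε'∋w =
    f-proper _ _
      (ε≢ε' ∘ edgeIndex-injective , _ , meets⇒incident ε∋w , meets⇒incident ε'∋w)

  isSimple : (between : V → V → Maybe E) →
    (∀ ε → between (src ε) (tgt ε) ≡ just ε) →
    (∀ ε → between (tgt ε) (src ε) ≡ nothing) →
    IsSimple graph
  isSimple between forward backward x x' (inj₁ (p , q)) = edgeAt-injective (just-injective (begin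
    just (edgeAt x)                             ≡⟨ forward (edgeAt x) ⟨
    between (src (edgeAt x)) (tgt (edgeAt x))   ≡⟨ cong₂ between (vertexIndex-injective p)
                                                                 (vertexIndex-injective q) ⟩
    between (src (edgeAt x')) (tgt (edgeAt x')) ≡⟨ forward (edgeAt x') ⟩
    just (edgeAt x')                            ∎))
    where open ≡-Reasoning
  isSimple between forward backward x x' (inj₂ (p , q)) = contradiction just≡nothing λ ()
    where
    open ≡-Reasoning
    just≡nothing : just (edgeAt x') ≡ nothing
    just≡nothing = begin
      just (edgeAt x')                            ≡⟨ forward (edgeAt x') ⟨
      between (src (edgeAt x')) (tgt (edgeAt x')) ≡⟨ cong₂ between (vertexIndex-injective (sym q))
                                                                   (vertexIndex-injective (sym p)) ⟩
      between (tgt (edgeAt x)) (src (edgeAt x))   ≡⟨ backward (edgeAt x) ⟩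
      nothing                                     ∎

  ProperOn-injective : ∀ {t c m w} → ProperOn t c →
    (g : Fin m → E) → Injective _≡_ _≡_ g → (∀ i → Meets (g i) w) → Injective _≡_ _≡_ (c ∘ g)
  ProperOn-injective c-proper g g-injective g∋w {i} {j} eq =
    decidable-stable (i ≟ j) λ i≢j → c-proper (i≢j ∘ g-injective) (g∋w i) (g∋w j) eq

  starOf : ∀ {m w} (g : Fin m → E) → Injective _≡_ _≡_ g → (∀ i → Meets (g i) w) →
    Star graph (vertexIndex w) m
  starOf g g-injective g∋w =
    star (edgeIndex ∘ g) (g-injective ∘ edgeIndex-injective) (meets⇒incident ∘ g∋w)

Class1Bound : ℕ → Set
Class1Bound C =
  ∀ H → IsSimple H → IsClass1 H → ∀ k → IsChromaticIndex H k → TransAtMost H k C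

-- The gadget of an edge e is K_{k,k} on left e i and right e j minus the edge
-- left e 0 — right e 0, plus the pendant edges end₁ e — left e 0 (entry) and
-- right e 0 — end₂ e (exit).
module EdgeGadget (G : Multigraph) (k' : ℕ) where

  k : ℕ
  k = suc k'

  Vertex : Set
  Vertex = Fin (nV G) ⊎ (Fin (nE G) × (Fin k ⊎ Fin k))

  pattern old u     = inj₁ u
  pattern left e i  = inj₂ (e , inj₁ i)
  pattern right e j = inj₂ (e , inj₂ j)

  -- Cell (i , j) is the edge left e i — right e j, except that the removed
  -- cell (0 , 0) is reused for entry.
  Slot : Set
  Slot = (Fin k × Fin k) ⊎ ⊤

  pattern cell i j = inj₁ (i , j)
  pattern entry    = inj₁ (zero , zero)
  pattern exit     = inj₂ tt

  Edge : Set
  Edge = Fin (nE G) × Slot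

  src tgt : Edge → Vertex
  src (e , entry)    = old (end₁ G e)
  src (e , cell i j) = left e i
  src (e , exit)     = right e zero
  tgt (e , entry)    = left e zero
  tgt (e , cell i j) = right e j
  tgt (e , exit)     = old (end₂ G e)

  src≢tgt : ∀ ε → src ε ≢ tgt ε
  src≢tgt (e , entry)          ()
  src≢tgt (e , cell zero (suc j)) ()
  src≢tgt (e , cell (suc i) j) ()
  src≢tgt (e , exit)           ()

  vertices : Fin (nV G + nE G * (k + k)) ↔ Vertex
  vertices = ↔-trans +↔⊎ (↔-refl ⊎-↔ ↔-trans *↔× (↔-refl ×-↔ +↔⊎))

  edges : Fin (nE G * (k * k + 1)) ↔ Edge
  edges = ↔-trans *↔× (↔-refl ×-↔ ↔-trans +↔⊎ (*↔× ⊎-↔ 1↔⊤))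

  open Enumerated vertices edges src tgt src≢tgt public

  between : Vertex → Vertex → Maybe Edge
  between (old _)    (left e _)  = just (e , entry)
  between (left e i) (right _ j) = just (e , cell i j)
  between (right e _) (old _)    = just (e , exit)
  between _          _           = nothing

  graph-simple : IsSimple graph
  graph-simple = isSimple between forward backward
    where
    forward : ∀ ε → between (src ε) (tgt ε) ≡ just ε
    forward (e , entry)             = refl
    forward (e , cell zero (suc j)) = refl
    forward (e , cell (suc i) j)    = refl
    forward (e , exit)              = refl

    backward : ∀ ε → between (tgt ε) (src ε) ≡ nothing
    backward (e , entry)             = refl
    backward (e , cell zero (suc j)) = refl
    backward (e , cell (suc i) j)    = refl
    backward (e , exit)              = refl

  columnSlot : Fin k → Fin k → Slot
  columnSlot zero zero = exit
  columnSlot i    j    = cell i j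

  coords : Slot → Fin k × Fin k
  coords (cell i j) = i , j
  coords exit       = zero , zero

  coords-columnSlot : ∀ i j → coords (columnSlot i j) ≡ (i , j)
  coords-columnSlot zero    zero    = refl
  coords-columnSlot zero    (suc j) = refl
  coords-columnSlot (suc i) j       = refl

  columnSlot-injective : ∀ e j → Injective _≡_ _≡_ (λ i → Edge ∋ (e , columnSlot i j))
  columnSlot-injective e j {i} {i'} eq =
    cong proj₁ (trans (sym (coords-columnSlot i j))
      (trans (cong (coords ∘ proj₂) eq) (coords-columnSlot i' j)))

  meets-left⁻ : ∀ {ε e i} → Meets ε (left e i) → ∃ λ j → ε ≡ (e , cell i j)
  meets-left⁻ {_ , entry}             (inj₁ ())
  meets-left⁻ {_ , entry}             (inj₂ refl) = zero , refl
  meets-left⁻ {_ , cell zero (suc j)} (inj₁ refl) = suc j , refl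
  meets-left⁻ {_ , cell zero (suc j)} (inj₂ ())
  meets-left⁻ {_ , cell (suc i) j}    (inj₁ refl) = j , refl
  meets-left⁻ {_ , cell (suc i) j}    (inj₂ ())
  meets-left⁻ {_ , exit}              (inj₁ ())
  meets-left⁻ {_ , exit}              (inj₂ ())

  meets-right⁻ : ∀ {ε e j} → Meets ε (right e j) → ∃ λ i → ε ≡ (e , columnSlot i j)
  meets-right⁻ {_ , entry}             (inj₁ ())
  meets-right⁻ {_ , entry}             (inj₂ ())
  meets-right⁻ {_ , cell zero (suc j)} (inj₁ ())
  meets-right⁻ {_ , cell zero (suc j)} (inj₂ refl) = zero , refl
  meets-right⁻ {_ , cell (suc i) j}    (inj₁ ())
  meets-right⁻ {_ , cell (suc i) j}    (inj₂ refl) = suc i , refl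
  meets-right⁻ {_ , exit}              (inj₁ refl) = zero , refl
  meets-right⁻ {_ , exit}              (inj₂ ())

  PendantAt : Fin (nV G) → Fin (nE G) → Slot → Set
  PendantAt u e s = (s ≡ entry × end₁ G e ≡ u) ⊎ (s ≡ exit × end₂ G e ≡ u)

  meets-old⁻ : ∀ {e s u} → Meets (e , s) (old u) → PendantAt u e s
  meets-old⁻ {s = entry}             (inj₁ refl) = inj₁ (refl , refl)
  meets-old⁻ {s = entry}             (inj₂ ())
  meets-old⁻ {s = cell zero (suc j)} (inj₁ ())
  meets-old⁻ {s = cell zero (suc j)} (inj₂ ())
  meets-old⁻ {s = cell (suc i) j}    (inj₁ ())
  meets-old⁻ {s = cell (suc i) j}    (inj₂ ())
  meets-old⁻ {s = exit}              (inj₁ ())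
  meets-old⁻ {s = exit}              (inj₂ refl) = inj₂ (refl , refl)

  meets-left⁺ : ∀ e i j → Meets (e , cell i j) (left e i)
  meets-left⁺ e zero    zero    = inj₂ refl
  meets-left⁺ e zero    (suc j) = inj₁ refl
  meets-left⁺ e (suc i) j       = inj₁ refl

  meets-right⁺ : ∀ e i j → Meets (e , columnSlot i j) (right e j)
  meets-right⁺ e zero    zero    = inj₁ refl
  meets-right⁺ e zero    (suc j) = inj₂ refl
  meets-right⁺ e (suc i) j       = inj₂ refl

  latinColoring : Coloring G k → Edge → Fin k
  latinColoring f (e , s) = uncurry (cyclicSquare (f e)) (coords s)

  latinColoring-properOn : ∀ {f} → Proper G k f → ProperOn k (latinColoring f)
  latinColoring-properOn {f} f-proper {e , s} {e' , s'} {old u} ε≢ε' ε∋u ε'∋u eq with e ≟ e'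
  ... | no e≢e' =
    f-proper e e' (e≢e' , u , incident (meets-old⁻ ε∋u) , incident (meets-old⁻ ε'∋u))
    (trans (sym (pendant-color (meets-old⁻ ε∋u))) (trans eq (pendant-color (meets-old⁻ ε'∋u))))
    where
    incident : ∀ {e s} → PendantAt u e s → Incident G e u
    incident (inj₁ (_ , p)) = inj₁ p
    incident (inj₂ (_ , p)) = inj₂ p

    pendant-color : ∀ {e s} → PendantAt u e s → latinColoring f (e , s) ≡ f e
    pendant-color (inj₁ (refl , _)) = cyclicSquare-corner _
    pendant-color (inj₂ (refl , _)) = cyclicSquare-corner _
  ... | yes refl with meets-old⁻ ε∋u | meets-old⁻ ε'∋u
  ...   | inj₁ (refl , _) | inj₁ (refl , _) = ε≢ε' refl
  ...   | inj₁ (refl , p) | inj₂ (refl , q) = loopless G e (trans p (sym q))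
  ...   | inj₂ (refl , p) | inj₁ (refl , q) = loopless G e (trans q (sym p))
  ...   | inj₂ (refl , _) | inj₂ (refl , _) = ε≢ε' refl
  latinColoring-properOn {f} f-proper {w = left e i} ε≢ε' ε∋w ε'∋w eq
    with meets-left⁻ ε∋w | meets-left⁻ ε'∋w
  ... | j , refl | j' , refl =
    ε≢ε' (cong (λ j → e , cell i j) (cyclicSquare-row-injective (f e) i eq))
  latinColoring-properOn {f} f-proper {w = right e j} ε≢ε' ε∋w ε'∋w eq
    with meets-right⁻ ε∋w | meets-right⁻ ε'∋w
  ... | i , refl | i' , refl = ε≢ε' (cong (λ i → e , columnSlot i j)
    (cyclicSquare-column-injective (f e) j (trans (sym (column-color i)) (trans eq (column-color i')))))
    where
    column-color : ∀ i → latinColoring f (e , columnSlot i j) ≡ cyclicSquare (f e) i j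
    column-color i = cong (uncurry (cyclicSquare (f e))) (coords-columnSlot i j)

  entry≡exit : ∀ {h} → ProperOn k h → ∀ e → h (e , entry) ≡ h (e , exit)
  entry≡exit {h} h-proper e = corner-agrees
    (λ i j → h (e , cell i j)) (λ j i → h (e , columnSlot i j))
    (λ i → ProperOn-injective h-proper (λ j → e , cell i j) (λ { refl → refl }) (meets-left⁺ e i))
    (λ j → ProperOn-injective h-proper (λ i → e , columnSlot i j) (columnSlot-injective e j)
             (λ i → meets-right⁺ e i j))
    (λ i j → refl) (λ j → refl)

  entryColoring-proper : ∀ {h} → ProperOn k h → Proper G k (λ e → h (e , entry))
  entryColoring-proper {h} h-proper e e' (e≢e' , u , e∋u , e'∋u) eq =
    h-proper (e≢e' ∘ cong proj₁) (meets e∋u) (meets e'∋u)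
      (trans (sym (entry≡slotAt e∋u)) (trans eq (entry≡slotAt e'∋u)))
    where
    slotAt : ∀ {e} → Incident G e u → Slot
    slotAt (inj₁ _) = entry
    slotAt (inj₂ _) = exit

    meets : ∀ {e} (e∋u : Incident G e u) → Meets (e , slotAt e∋u) (old u)
    meets (inj₁ p) = inj₁ (cong old p)
    meets (inj₂ p) = inj₂ (cong old p)

    entry≡slotAt : ∀ {e} (e∋u : Incident G e u) → h (e , entry) ≡ h (e , slotAt e∋u)
    entry≡slotAt (inj₁ _) = refl
    entry≡slotAt {e} (inj₂ _) = entry≡exit h-proper e

  private
    ι : Fin (nE G) → Fin (nE graph)
    ι e = edgeIndex (e , entry)

    extend : Coloring G k → Coloring graph k
    extend f = latinColoring f ∘ edgeAt

    extend-proper : ∀ f → Proper G k f → Proper graph k (extend f)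
    extend-proper f = properOn⇒proper ∘ latinColoring-properOn

  transAtMost : ∀ {C} → Class1Bound C → IsChromaticIndex G k → TransAtMost G k C
  transAtMost {C} bound χ@((f , f-proper) , _) =
    lower (bound graph graph-simple (isClass1-fromStar H-proper star₀)
                 k (isChromaticIndex-fromStar H-proper star₀))
    where
    H-proper = extend-proper f f-proper
    e₀ = χ'>0⇒edge {G} χ
    star₀ = starOf (λ j → e₀ , cell zero j) (λ { refl → refl }) (meets-left⁺ e₀ zero)

    lower : TransAtMost graph k C → TransAtMost G k C
    lower (n , 2≤n , n≤C , equivalent) = n , 2≤n , n≤C ,
      AllEquivalent-retract ι extend (λ a → entryColoring-proper ∘ proper⇒properOn) extend-proper
        (λ f e → trans (cong (latinColoring f) (edgeAt-edgeIndex (e , entry)))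
                       (cyclicSquare-corner (f e)))
        equivalent

TransAtMost-mono : ∀ {G k C C'} → C ≤ C' → TransAtMost G k C → TransAtMost G k C'
TransAtMost-mono C≤C' (n , 2≤n , n≤C , equivalent) =
  n , 2≤n , ℕ.≤-trans n≤C C≤C' , equivalent

multigraphBound : ∀ {C} → Class1Bound C →
  ∀ G k → IsChromaticIndex G k → TransAtMost G k (C ⊔ 2)
multigraphBound {C} bound G zero     _ =
  2 , ℕ.≤-refl , ℕ.m≤n⊔m C 2 , AllEquivalent-≥colors z≤n
multigraphBound {C} bound G (suc k') χ =
  TransAtMost-mono (ℕ.m≤m⊔n C 2) (EdgeGadget.transAtMost G k' bound χ)

proposition5p1 : (Σ ℕ λ C →
    (∀ (G : Multigraph) → IsSimple G → ∀ k → IsChromaticIndex G k → TransAtMost G k C)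
    × (∀ (G : Multigraph) → ∀ k → IsChromaticIndex G k → TransAtMost G k C))
    ⇔
    (Σ ℕ λ C →
    ∀ (H : Multigraph) → IsSimple H → IsClass1 H → ∀ k → IsChromaticIndex H k → TransAtMost H k C)
proposition5p1 = mk⇔
  (λ (C , _ , multigraphs) → C , λ H _ _ → multigraphs H)
  (λ (C , bound) → C ⊔ 2 , (λ G _ → multigraphBound bound G) , multigraphBound bound)
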